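{- Let $T$ be an irreducible, minimum-cost two-way-comparison decision tree for an instance $(Q,w,\mathcal C,K)$. Let $j\ge1$ and let $u_1\to u_2\to\cdots\to u_{j+1}$ be any downward path in $T$, with $u_i'$ the sibling of $u_i$. For $1\le i\le j-1$, let $\delta_i$ be the number of indices $s\in\{1,\dots,i-1\}$ such that the outcomes $u_s\to u_{s+1}'$ and $u_i\to u_{i+1}'$ are consistent with opposite outcomes at $u_j$. Let $\beta$ be the number of indices $s\in\{1,\dots,j-1\}$ such that the outcome $u_s\to u_{s+1}'$ is consistent with the outcome $u_j\to u_{j+1}$ (so $0\le\beta\le j-1$). Then \[ w(u_2')\;\ge\;(j-1-\beta)\,w(u_{j+1})+\beta\, w(u_{j+1}')+\sum_{i=3}^{j}(\delta_{i-1}-1)\,w(u_i'). \]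
   Context: An instance $(Q,w,\mathcal C,K)$ consists of a totally ordered finite set $Q$ of queries with weights $w(q)\ge0$, a collection $\mathcal C\subseteq 2^Q$ of classes, and a set $K\subseteq Q$ of keys; every query belongs to some class. An allowed test is "$q<k$" for some $k\in K$ with $\min Q<k\le\max Q$, or "$q=k$" for some $k\in K$. A two-way-comparison decision tree is a rooted binary tree whose non-leaf nodes are allowed tests, with children labeled by the outcomes yes/no, and whose leaves are labeled by classes, each leaf's class containing every query whose search ends there. The search for $q$ starts at the root and moves to the yes-child if $q$ satisfies the test and to the no-child otherwise; $q$ reaches every node on its search path; its depth is the number of tests on the path; the cost of the tree is $\sum_q w(q)\,\mathrm{depth}(q)$. $Q_u$ is the set of queries reaching node $u$, and $w(u)=\sum_{q\in Q_u}w(q)$. The tree is irreducible if for every node $u$, at least one query reaches $u$, and if some class contains all of $Q_u$ then $u$ is a leaf. An edge $u\to v$ to a child is identified with the corresponding outcome at $u$. Two outcomes are consistent if some query in $Q$ satisfies both, otherwise inconsistent.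
   Formalization: The query weights $w(q)$ take values in the nonnegative rationals. -}

module Defs where

open import Data.Nat as ℕ using (ℕ; zero; suc; _∸_)
open import Data.Fin as Fin using (Fin; toℕ)
open import Data.Fin.Properties using (_≟_; _<?_)
open import Data.Fin.Subset using (Subset; _∈_)
open import Data.Bool using (Bool; true; false; not; _∧_; _∨_; if_then_else_)
open import Data.List using (List; []; _∷_; _++_; take; allFin)
open import Data.Bool.ListAction using (any)
open import Data.Maybe using (Maybe; just; nothing; Is-just)
open import Data.Product using (Σ; ∃; _×_; _,_)
open import Data.Integer using (+_)
open import Data.Rational using (ℚ; _/_; 0ℚ; _+_; _*_; _≤_)
open import Data.Unit using (⊤)
open import Relation.Binary.PropositionalEquality using (_≡_)
open import Relation.Nullary.Decidable using (⌊_⌋)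

-- Instance conventions
-- Q = Fin n with its natural total order; weights w : Fin n → ℚ;
-- classes C : Fin m → Subset n (class number c is the set C c);
-- keys K : Subset n.

data Test (n : ℕ) : Set where
  lt : Fin n → Test n
  eq : Fin n → Test n

sat : ∀ {n} → Test n → Fin n → Bool
sat (lt k) q = ⌊ q <? k ⌋
sat (eq k) q = ⌊ q ≟ k ⌋

-- allowed tests: "q < k" needs k ∈ K and min Q < k (k ≤ max Q is automatic);
-- "q = k" needs k ∈ K
Allowed : ∀ {n} → Subset n → Test n → Set
Allowed K (lt k) = (k ∈ K) × (0 ℕ.< toℕ k)
Allowed K (eq k) = k ∈ K

-- Binary decision trees; leaves labelled by a class index.
-- node t yes no : the first subtree is the yes-child, the second the no-child.
data Tree (n m : ℕ) : Set where
  leaf : Fin m → Tree n m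
  node : Test n → Tree n m → Tree n m → Tree n m

-- Nodes are addressed by positions: the list of outcomes from the root
-- (true = yes-child, false = no-child).
Pos : Set
Pos = List Bool

subtree : ∀ {n m} → Tree n m → Pos → Maybe (Tree n m)
subtree t [] = just t
subtree (leaf _) (_ ∷ _) = nothing
subtree (node _ y _) (true ∷ p) = subtree y p
subtree (node _ _ o) (false ∷ p) = subtree o p

IsNode : ∀ {n m} → Tree n m → Pos → Set
IsNode T p = Is-just (subtree T p)

IsLeafAt : ∀ {n m} → Tree n m → Pos → Set
IsLeafAt T p = ∃ λ c → subtree T p ≡ just (leaf c)

reaches : ∀ {n m} → Tree n m → Pos → Fin n → Bool
reaches t [] q = true
reaches (leaf _) (_ ∷ _) q = false
reaches (node t y _) (true ∷ p) q = sat t q ∧ reaches y p q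
reaches (node t _ o) (false ∷ p) q = not (sat t q) ∧ reaches o p q

-- does q satisfy the outcome b (true = yes, false = no) of the test at the
-- node at position p ?  (false if p is not an internal node)
outSat : ∀ {n m} → Tree n m → Pos → Bool → Fin n → Bool
outSat (leaf _) [] b q = false
outSat (node t _ _) [] true q = sat t q
outSat (node t _ _) [] false q = not (sat t q)
outSat (leaf _) (_ ∷ _) b q = false
outSat (node _ y _) (true ∷ p) b q = outSat y p b q
outSat (node _ _ o) (false ∷ p) b q = outSat o p b q

consistent : ∀ {n m} → Tree n m → Pos → Bool → Pos → Bool → Bool
consistent {n} T p₁ b₁ p₂ b₂ = any (λ q → outSat T p₁ b₁ q ∧ outSat T p₂ b₂ q) (allFin n)

AllowedTests : ∀ {n m} → Subset n → Tree n m → Set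
AllowedTests K (leaf _) = ⊤
AllowedTests K (node t y o) = Allowed K t × AllowedTests K y × AllowedTests K o

IsDecisionTree : ∀ {n m} → (Fin m → Subset n) → Subset n → Tree n m → Set
IsDecisionTree {n} {m} C K T =
  AllowedTests K T ×
  (∀ (p : Pos) (c : Fin m) → subtree T p ≡ just (leaf c) →
     ∀ (q : Fin n) → reaches T p q ≡ true → q ∈ C c)

Irreducible : ∀ {n m} → (Fin m → Subset n) → Tree n m → Set
Irreducible {n} {m} C T =
  ∀ (p : Pos) → IsNode T p →
    (∃ λ (q : Fin n) → reaches T p q ≡ true) ×
    ((∃ λ (c : Fin m) → ∀ (q : Fin n) → reaches T p q ≡ true → q ∈ C c) → IsLeafAt T p)

sumFin : ∀ {n} → (Fin n → ℚ) → ℚ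
sumFin {zero} f = 0ℚ
sumFin {suc n} f = f Fin.zero + sumFin (λ i → f (Fin.suc i))

-- Σ_{i=a}^{b} f i  (ℕ indices, empty if b < a)
sumRange : ℕ → ℕ → (ℕ → ℚ) → ℚ
sumRange a zero f = if ⌊ a ℕ.≟ 0 ⌋ then f 0 else 0ℚ
sumRange a (suc b) f = if ⌊ a ℕ.≤? suc b ⌋ then sumRange a b f + f (suc b) else 0ℚ

countRange : ℕ → ℕ → (ℕ → Bool) → ℕ
countRange a zero P = if ⌊ a ℕ.≟ 0 ⌋ ∧ P 0 then 1 else 0
countRange a (suc b) P = countRange a b P ℕ.+ (if ⌊ a ℕ.≤? suc b ⌋ ∧ P (suc b) then 1 else 0)

depth : ∀ {n m} → Tree n m → Fin n → ℕ
depth (leaf _) q = 0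
depth (node t y o) q = suc (if sat t q then depth y q else depth o q)

ℕtoℚ : ℕ → ℚ
ℕtoℚ k = + k / 1

cost : ∀ {n m} → (Fin n → ℚ) → Tree n m → ℚ
cost w T = sumFin (λ q → w q * ℕtoℚ (depth T q))

weight : ∀ {n m} → (Fin n → ℚ) → Tree n m → Pos → ℚ
weight w T p = sumFin (λ q → if reaches T p q then w q else 0ℚ)

-- a downward path u₁ → u₂ → ⋯ → u_{j+1}, given by the position p of u₁ and
-- the list d of the j outcomes taken (length d ≡ j).  Indices are 1-based.

nth : List Bool → ℕ → Bool
nth [] _ = false
nth (b ∷ _) zero = b
nth (_ ∷ bs) (suc i) = nth bs i

-- position of u_i  (1 ≤ i ≤ j+1)
pathNode : Pos → List Bool → ℕ → Pos
pathNode p d i = p ++ take (i ∸ 1) d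

-- outcome taken at u_i on the path, i.e. the edge u_i → u_{i+1}  (1 ≤ i ≤ j)
pathDir : List Bool → ℕ → Bool
pathDir d i = nth d (i ∸ 1)

-- position of u_i', the sibling of u_i  (2 ≤ i ≤ j+1)
sibling : Pos → List Bool → ℕ → Pos
sibling p d i = pathNode p d (i ∸ 1) ++ (not (pathDir d (i ∸ 1)) ∷ [])

-- the outcome u_s → u_{s+1}' is (pathNode p d s , not (pathDir d s)).
-- δ_i : number of s ∈ {1,…,i-1} such that the outcomes u_s → u_{s+1}' and
-- u_i → u_{i+1}' are consistent with opposite outcomes at u_j
oppositeAtUj : ∀ {n m} → Tree n m → Pos → List Bool → ℕ → ℕ → ℕ → Bool
oppositeAtUj T p d j s i =
  (consistent T (pathNode p d s) (not (pathDir d s)) (pathNode p d j) true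
    ∧ consistent T (pathNode p d i) (not (pathDir d i)) (pathNode p d j) false)
  ∨ (consistent T (pathNode p d s) (not (pathDir d s)) (pathNode p d j) false
    ∧ consistent T (pathNode p d i) (not (pathDir d i)) (pathNode p d j) true)

delta : ∀ {n m} → Tree n m → Pos → List Bool → ℕ → ℕ → ℕ
delta T p d j i = countRange 1 (i ∸ 1) (λ s → oppositeAtUj T p d j s i)

beta : ∀ {n m} → Tree n m → Pos → List Bool → ℕ → ℕ
beta T p d j = countRange 1 (j ∸ 1)
  (λ s → consistent T (pathNode p d s) (not (pathDir d s)) (pathNode p d j) (pathDir d j))

-- Let T′ replace the subtree at u₁ by a tree that first asks the test of u_j and
-- then, on each outcome b, asks only those tests of u₁, …, u_{j-1} whose exit edge
-- u_s → u′_{s+1} is consistent with b, ending in the b-child of u_j. Both children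
-- of u_j are reached, and no comparison splits both sides of another one, so each
-- exit edge is consistent with at most one outcome at u_j: the dropped tests are
-- answered by the path direction, every query keeps its leaf, and T′ is again a
-- decision tree. Query by query, one reaching u_{j+1} saves j-1-β tests, one
-- leaving at u_j saves at least β, one leaving into u′_{i+1} (3 ≤ i+1 ≤ j) saves at
-- least δ_i - 1, and only the queries of u′₂ can get one test deeper. Weighting and
-- summing, cost T′ + LHS ≤ cost T + w(u′₂), while cost T ≤ cost T′ by minimality.

module Submission where

open import Defs
open import Data.Nat using (ℕ; _∸_)
open import Data.Fin using (Fin)
open import Data.Fin.Subset using (Subset; _∈_)
open import Data.Bool using (Bool)
open import Data.List using (List; length; _++_)
open import Data.Product using (∃)
open import Data.Rational using (ℚ; 0ℚ; 1ℚ; _+_; _-_; _*_; _≤_)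
open import Relation.Binary.PropositionalEquality using (_≡_)

open import Data.Nat using (zero; suc; z≤n; s≤s)
  renaming (_+_ to _+ₙ_; _≤_ to _≤ₙ_; _<_ to _<ₙ_)
import Data.Nat.Properties as ℕₚ
open import Data.Nat.Solver using () renaming (module +-*-Solver to ℕ-Solver)
open import Data.Fin using (toℕ) renaming (zero to fzero; suc to fsuc)
open import Data.Fin.Properties using (_≟_; _<?_)
open import Data.Bool using (true; false; not; _∧_; _∨_; if_then_else_)
open import Data.Bool.Properties
  using (∧-conicalˡ; ∧-conicalʳ; ∧-assoc; ∧-identityʳ; ∧-zeroʳ; not-involutive; T-≡; T-not-≡)
open import Data.List using ([]; _∷_; take; allFin)
import Data.List.Properties as Listₚ
open import Data.List.Membership.Propositional using (lose)
open import Data.List.Membership.Propositional.Properties using (∈-allFin)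
open import Data.List.Relation.Unary.Any using (satisfied)
open import Data.List.Relation.Unary.Any.Properties using (any⁺; any⁻)
open import Data.Maybe using (Maybe; just; nothing; fromMaybe; Is-just)
import Data.Maybe.Relation.Unary.Any as MaybeAny
open import Data.Product using (_×_; _,_; proj₁; proj₂; ∃-syntax)
open import Data.Sum using (_⊎_; inj₁; inj₂)
open import Data.Empty using (⊥; ⊥-elim)
open import Data.Unit using (tt)
import Data.Integer.Properties as ℤₚ
import Data.Nat.Coprimality as Coprimality
open import Data.Rational using (-_; nonNegative)
import Data.Rational.Properties as ℚₚ
open import Data.Rational.Solver using () renaming (module +-*-Solver to ℚ-Solver)
open import Function.Bundles using (Equivalence)
open import Relation.Binary.PropositionalEquality
  using (refl; sym; trans; cong; cong₂; subst; subst₂; _≢_; module ≡-Reasoning)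
open import Relation.Binary.Definitions using (tri<; tri≈; tri>)
open import Relation.Nullary using (yes; no)
open import Relation.Nullary.Decidable using (⌊_⌋; toWitness; toWitnessFalse)

private
  variable
    n m : ℕ

-- Arithmetic

ℕtoℚ-suc : ∀ k → ℕtoℚ (suc k) ≡ 1ℚ + ℕtoℚ k
ℕtoℚ-suc k =
  trans (ℚₚ./-cong {p₁ = + suc k} {q₁ = 1} {p₂ = + 1 ℤ* + 1 ℤ+ + k ℤ* + 1} {q₂ = 1}
                   (cong (λ x → + 1 ℤ+ x) (sym (ℤₚ.*-identityʳ (+ k)))) refl)
        (cong (λ x → 1ℚ + x) (sym (ℚₚ.normalize-coprime (Coprimality.sym (Coprimality.1-coprimeTo k)))))
  where open import Data.Integer using (+_) renaming (_+_ to _ℤ+_; _*_ to _ℤ*_)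

ℕtoℚ-+ : ∀ a b → ℕtoℚ (a +ₙ b) ≡ ℕtoℚ a + ℕtoℚ b
ℕtoℚ-+ zero    b = sym (ℚₚ.+-identityˡ (ℕtoℚ b))
ℕtoℚ-+ (suc a) b = begin
  ℕtoℚ (suc (a +ₙ b))         ≡⟨ ℕtoℚ-suc (a +ₙ b) ⟩
  1ℚ + ℕtoℚ (a +ₙ b)          ≡⟨ cong (1ℚ +_) (ℕtoℚ-+ a b) ⟩
  1ℚ + (ℕtoℚ a + ℕtoℚ b)      ≡⟨ sym (ℚₚ.+-assoc 1ℚ (ℕtoℚ a) (ℕtoℚ b)) ⟩
  (1ℚ + ℕtoℚ a) + ℕtoℚ b      ≡⟨ cong (_+ ℕtoℚ b) (sym (ℕtoℚ-suc a)) ⟩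
  ℕtoℚ (suc a) + ℕtoℚ b       ∎
  where open ≡-Reasoning

ℕtoℚ-nonNeg : ∀ k → 0ℚ ≤ ℕtoℚ k
ℕtoℚ-nonNeg k = ℚₚ.nonNegative⁻¹ (ℕtoℚ k) {{ℚₚ.normalize-nonNeg k 1}}

ℕtoℚ-mono-≤ : ∀ {a b} → a ≤ₙ b → ℕtoℚ a ≤ ℕtoℚ b
ℕtoℚ-mono-≤ {a} {b} a≤b = begin
  ℕtoℚ a                   ≡⟨ sym (ℚₚ.+-identityʳ (ℕtoℚ a)) ⟩
  ℕtoℚ a + 0ℚ              ≤⟨ ℚₚ.+-monoʳ-≤ (ℕtoℚ a) (ℕtoℚ-nonNeg (b ∸ a)) ⟩
  ℕtoℚ a + ℕtoℚ (b ∸ a)    ≡⟨ sym (ℕtoℚ-+ a (b ∸ a)) ⟩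
  ℕtoℚ (a +ₙ (b ∸ a))      ≡⟨ cong ℕtoℚ (ℕₚ.m+[n∸m]≡n a≤b) ⟩
  ℕtoℚ b                   ∎
  where open ℚₚ.≤-Reasoning

amortised-≤ : ∀ {w I} d′ d a b e → 0ℚ ≤ w → ℕtoℚ e * w ≤ I → d′ +ₙ a ≤ₙ d +ₙ e +ₙ b →
  w * ℕtoℚ d′ + (ℕtoℚ a - ℕtoℚ b) * w ≤ w * ℕtoℚ d + I
amortised-≤ {w} {I} d′ d a b e w≥0 ew≤I ineq = begin
  w * N d′ + (N a - N b) * w           ≡⟨ solve 4 (λ w x a b → w :* x :+ (a :- b) :* w := w :* (x :+ a) :- w :* b) refl w (N d′) (N a) (N b) ⟩
  w * (N d′ + N a) - w * N b           ≡⟨ cong (λ x → w * x - w * N b) (sym (ℕtoℚ-+ d′ a)) ⟩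
  w * N (d′ +ₙ a) - w * N b            ≤⟨ ℚₚ.+-monoˡ-≤ (- (w * N b)) (ℚₚ.*-monoˡ-≤-nonNeg w {{nonNegative w≥0}} (ℕtoℚ-mono-≤ ineq)) ⟩
  w * N (d +ₙ e +ₙ b) - w * N b        ≡⟨ cong (λ x → w * x - w * N b) (trans (ℕtoℚ-+ (d +ₙ e) b) (cong (_+ N b) (ℕtoℚ-+ d e))) ⟩
  w * (N d + N e + N b) - w * N b      ≡⟨ solve 4 (λ w x y z → w :* (x :+ y :+ z) :- w :* z := w :* x :+ y :* w) refl w (N d) (N e) (N b) ⟩
  w * N d + N e * w                    ≤⟨ ℚₚ.+-monoʳ-≤ (w * N d) ew≤I ⟩
  w * N d + I                          ∎
  where
  open ℚₚ.≤-Reasoning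
  open ℚ-Solver using (solve; _:+_; _:*_; _:-_; _:=_)
  N : ℕ → ℚ
  N = ℕtoℚ

a+x≤b+y∧b≤a⇒x≤y : ∀ {a b x y} → a + x ≤ b + y → b ≤ a → x ≤ y
a+x≤b+y∧b≤a⇒x≤y {a} {b} {x} {y} ineq b≤a = begin
  x                  ≡⟨ solve 2 (λ a x → x := a :+ x :- a) refl a x ⟩
  a + x - a          ≤⟨ ℚₚ.+-monoˡ-≤ (- a) ineq ⟩
  b + y - a          ≤⟨ ℚₚ.+-monoʳ-≤ (b + y) (ℚₚ.neg-antimono-≤ b≤a) ⟩
  b + y - b          ≡⟨ solve 2 (λ b y → b :+ y :- b := y) refl b y ⟩
  y                  ∎
  where
  open ℚₚ.≤-Reasoning
  open ℚ-Solver using (solve; _:+_; _:-_; _:=_)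

-- Finite sums and counts

sumFin-+ : ∀ (f g : Fin n → ℚ) → sumFin (λ q → f q + g q) ≡ sumFin f + sumFin g
sumFin-+ {zero}  f g = refl
sumFin-+ {suc n} f g = begin
  f fzero + g fzero + sumFin (λ q → f (fsuc q) + g (fsuc q))
    ≡⟨ cong (λ x → f fzero + g fzero + x) (sumFin-+ (λ q → f (fsuc q)) (λ q → g (fsuc q))) ⟩
  f fzero + g fzero + (sumFin (λ q → f (fsuc q)) + sumFin (λ q → g (fsuc q)))
    ≡⟨ solve 4 (λ a b c d → a :+ b :+ (c :+ d) := a :+ c :+ (b :+ d)) refl (f fzero) (g fzero) _ _ ⟩
  f fzero + sumFin (λ q → f (fsuc q)) + (g fzero + sumFin (λ q → g (fsuc q))) ∎
  where
  open ≡-Reasoning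
  open ℚ-Solver using (solve; _:+_; _:=_)

sumFin-* : ∀ c (f : Fin n → ℚ) → sumFin (λ q → c * f q) ≡ c * sumFin f
sumFin-* {zero}  c f = sym (ℚₚ.*-zeroʳ c)
sumFin-* {suc n} c f =
  trans (cong (λ x → c * f fzero + x) (sumFin-* c (λ q → f (fsuc q))))
        (sym (ℚₚ.*-distribˡ-+ c _ _))

sumFin-0 : sumFin {n} (λ _ → 0ℚ) ≡ 0ℚ
sumFin-0 {zero}  = refl
sumFin-0 {suc n} = cong (0ℚ +_) (sumFin-0 {n})

sumFin-mono-≤ : ∀ {f g : Fin n → ℚ} → (∀ q → f q ≤ g q) → sumFin f ≤ sumFin g
sumFin-mono-≤ {zero}  f≤g = ℚₚ.≤-refl
sumFin-mono-≤ {suc n} f≤g = ℚₚ.+-mono-≤ (f≤g fzero) (sumFin-mono-≤ (λ q → f≤g (fsuc q)))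

sumFin-sumRange : ∀ a b (F : ℕ → Fin n → ℚ) →
  sumFin (λ q → sumRange a b (λ i → F i q)) ≡ sumRange a b (λ i → sumFin (F i))
sumFin-sumRange {n} a zero F with ⌊ a Data.Nat.≟ 0 ⌋
... | true  = refl
... | false = sumFin-0 {n}
sumFin-sumRange {n} a (suc b) F with ⌊ a Data.Nat.≤? suc b ⌋
... | true  = trans (sumFin-+ (λ q → sumRange a b (λ i → F i q)) (F (suc b)))
                    (cong (_+ sumFin (F (suc b))) (sumFin-sumRange a b F))
... | false = sumFin-0 {n}

sumRange-cong : ∀ a b {f g : ℕ → ℚ} → (∀ i → f i ≡ g i) → sumRange a b f ≡ sumRange a b g
sumRange-cong a zero    f≡g rewrite f≡g 0 = refl
sumRange-cong a (suc b) f≡g rewrite sumRange-cong a b f≡g | f≡g (suc b) = refl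

sumRange-zero : ∀ a b (f : ℕ → ℚ) → (∀ i → a ≤ₙ i → i ≤ₙ b → f i ≡ 0ℚ) → sumRange a b f ≡ 0ℚ
sumRange-zero a zero f f≡0 with a Data.Nat.≟ 0
... | yes refl = f≡0 0 z≤n z≤n
... | no _     = refl
sumRange-zero a (suc b) f f≡0 with a Data.Nat.≤? suc b
... | yes a≤1+b = trans (cong₂ _+_ (sumRange-zero a b f (λ i a≤i i≤b → f≡0 i a≤i (ℕₚ.m≤n⇒m≤1+n i≤b)))
                                   (f≡0 (suc b) a≤1+b ℕₚ.≤-refl))
                        (ℚₚ.+-identityˡ 0ℚ)
... | no _      = refl

sumRange-single : ∀ a b (f : ℕ → ℚ) k → a ≤ₙ k → k ≤ₙ b →
  (∀ i → a ≤ₙ i → i ≤ₙ b → i ≢ k → f i ≡ 0ℚ) → sumRange a b f ≡ f k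
sumRange-single a zero f k a≤k k≤0 f≡0 with a Data.Nat.≟ 0
... | yes refl = cong f (sym (ℕₚ.n≤0⇒n≡0 k≤0))
... | no a≢0   = ⊥-elim (a≢0 (ℕₚ.n≤0⇒n≡0 (ℕₚ.≤-trans a≤k k≤0)))
sumRange-single a (suc b) f k a≤k k≤1+b f≡0 with a Data.Nat.≤? suc b | k Data.Nat.≟ suc b
... | no a≰1+b | _      = ⊥-elim (a≰1+b (ℕₚ.≤-trans a≤k k≤1+b))
... | yes _    | yes refl =
  trans (cong (_+ f (suc b)) (sumRange-zero a b f (λ i a≤i i≤b → f≡0 i a≤i (ℕₚ.m≤n⇒m≤1+n i≤b) (ℕₚ.<⇒≢ (s≤s i≤b)))))
        (ℚₚ.+-identityˡ _)
... | yes a≤1+b | no k≢1+b =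
  trans (cong₂ _+_ (sumRange-single a b f k a≤k (ℕₚ.≤-pred (ℕₚ.≤∧≢⇒< k≤1+b k≢1+b))
                                    (λ i a≤i i≤b → f≡0 i a≤i (ℕₚ.m≤n⇒m≤1+n i≤b)))
                   (f≡0 (suc b) a≤1+b ℕₚ.≤-refl (λ 1+b≡k → k≢1+b (sym 1+b≡k))))
        (ℚₚ.+-identityʳ _)

count : (ℕ → Bool) → ℕ → ℕ
count P zero    = 0
count P (suc i) = count P i +ₙ (if P i then 1 else 0)

countRange-from-1 : ∀ P i → countRange 1 i P ≡ count (λ s → P (suc s)) i
countRange-from-1 P zero    = refl
countRange-from-1 P (suc i) = cong (_+ₙ (if P (suc i) then 1 else 0)) (countRange-from-1 P i)

count-disjoint : ∀ (P Q : ℕ → Bool) i → (∀ s → s <ₙ i → P s ≡ true → Q s ≡ false) →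
  count P i +ₙ count Q i ≤ₙ i
count-disjoint P Q zero    disj = z≤n
count-disjoint P Q (suc i) disj = begin
  count P i +ₙ bit (P i) +ₙ (count Q i +ₙ bit (Q i))
    ≡⟨ solve 4 (λ a b c d → a :+ b :+ (c :+ d) := a :+ c :+ (b :+ d)) refl (count P i) (bit (P i)) (count Q i) (bit (Q i)) ⟩
  count P i +ₙ count Q i +ₙ (bit (P i) +ₙ bit (Q i))
    ≤⟨ ℕₚ.+-mono-≤ (count-disjoint P Q i (λ s s<i → disj s (ℕₚ.m<n⇒m<1+n s<i))) (bits (P i) (Q i) (disj i ℕₚ.≤-refl)) ⟩
  i +ₙ 1
    ≡⟨ ℕₚ.+-comm i 1 ⟩
  suc i ∎
  where
  open ℕₚ.≤-Reasoning
  open ℕ-Solver using (solve; _:+_; _:=_)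
  bit : Bool → ℕ
  bit x = if x then 1 else 0
  bits : ∀ x y → (x ≡ true → y ≡ false) → bit x +ₙ bit y ≤ₙ 1
  bits true  true  excl with () ← excl refl
  bits true  false _    = ℕₚ.≤-refl
  bits false true  _    = ℕₚ.≤-refl
  bits false false _    = z≤n

-- Outcomes of two-way comparisons

outcome : Test n → Bool → Fin n → Bool
outcome t true  q = sat t q
outcome t false q = not (sat t q)

outcome-not : ∀ (t : Test n) b q → outcome t (not b) q ≡ not (outcome t b q)
outcome-not t true  q = refl
outcome-not t false q = sym (not-involutive _)

outcome-sat : ∀ (t : Test n) q → outcome t (sat t q) q ≡ true
outcome-sat t q with sat t q in e
... | true  = e
... | false = cong not e

outcome-unique : ∀ (t : Test n) b q → outcome t b q ≡ true → b ≡ sat t q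
outcome-unique t true  q h = sym h
outcome-unique t false q h with sat t q
... | false = refl
... | true  with () ← h

not-true : ∀ {b} → not b ≡ true → b ≡ false
not-true {false} _ = refl

Separates : Test n → (Fin n → Bool) → Set
Separates t A = ∃[ q ] ∃[ q′ ] A q ≡ true × A q′ ≡ true × sat t q ≡ true × sat t q′ ≡ false

-- The yes-set of a test is an initial segment or a single query, so a second
-- test cannot split both it and its complement.
¬separates-both-sides : ∀ (t t′ : Test n) b →
  Separates t′ (outcome t b) → Separates t′ (outcome t (not b)) → ⊥
¬separates-both-sides t t′ true  yes-side no-side = separates-yes-and-no t t′ yes-side no-side
  where
  <?-true : ∀ {q k : Fin n} → ⌊ q <? k ⌋ ≡ true → toℕ q <ₙ toℕ k
  <?-true h = toWitness (Equivalence.from T-≡ h)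
  <?-false : ∀ {q k : Fin n} → ⌊ q <? k ⌋ ≡ false → toℕ k ≤ₙ toℕ q
  <?-false h = ℕₚ.≮⇒≥ (toWitnessFalse (Equivalence.from T-not-≡ h))
  ≟-true : ∀ {q k : Fin n} → ⌊ q ≟ k ⌋ ≡ true → q ≡ k
  ≟-true h = toWitness (Equivalence.from T-≡ h)
  separates-yes-and-no : ∀ (t t′ : Test n) → Separates t′ (sat t) → Separates t′ (λ q → not (sat t q)) → ⊥
  separates-yes-and-no (eq k) t′ (q , q′ , q=k , q′=k , sat-q , sat-q′) _
    with () ← trans (sym sat-q) (trans (cong (sat t′) (trans (≟-true q=k) (sym (≟-true q′=k)))) sat-q′)
  separates-yes-and-no (lt k) (lt k′) (_ , q₂ , _ , q₂<k , _ , q₂≮k′) (q₃ , _ , q₃≮k , _ , q₃<k′ , _) =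
    ℕₚ.<-irrefl refl (ℕₚ.≤-<-trans (<?-false q₂≮k′)
      (ℕₚ.<-trans (<?-true q₂<k) (ℕₚ.≤-<-trans (<?-false (not-true q₃≮k)) (<?-true q₃<k′))))
  separates-yes-and-no (lt k) (eq k′) (q₁ , _ , q₁<k , _ , q₁=k′ , _) (q₃ , _ , q₃≮k , _ , q₃=k′ , _) =
    ℕₚ.<-irrefl refl (ℕₚ.<-≤-trans (<?-true q₁<k)
      (subst (λ x → toℕ k ≤ₙ toℕ x) (trans (≟-true q₃=k′) (sym (≟-true q₁=k′))) (<?-false (not-true q₃≮k))))
¬separates-both-sides t t′ false no-side yes-side = ¬separates-both-sides t t′ true yes-side no-side

opposite-sides-false : ∀ (f g : Bool → Bool) b → f (not b) ≡ false → g (not b) ≡ false →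
  (f true ∧ g false) ∨ (f false ∧ g true) ≡ false
opposite-sides-false f g true  f≡ g≡ rewrite f≡ | g≡ | ∧-zeroʳ (f true) = refl
opposite-sides-false f g false f≡ g≡ rewrite f≡ | g≡ | ∧-zeroʳ (f false) = refl

-- Positions in a tree

child : Bool → Tree n m → Tree n m
child true  (node _ y _) = y
child false (node _ _ o) = o
child _     (leaf c)     = leaf c

graft : Bool → Tree n m → Tree n m → Tree n m
graft true  (node t _ o) x = node t x o
graft false (node t y _) x = node t y x
graft _     (leaf _)     x = x

isJust⇒≡just : ∀ {A : Set} {x : Maybe A} → Is-just x → ∃[ a ] x ≡ just a
isJust⇒≡just (MaybeAny.just {x = a} _) = a , refl

≡just⇒isJust : ∀ {A : Set} {x : Maybe A} {a} → x ≡ just a → Is-just x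
≡just⇒isJust refl = MaybeAny.just tt

subtree-++ : ∀ (T : Tree n m) pos r {V} → subtree T pos ≡ just V → subtree T (pos ++ r) ≡ subtree V r
subtree-++ T            []            r refl = refl
subtree-++ (leaf _)     (_ ∷ _)       r ()
subtree-++ (node _ y _) (true ∷ pos)  r e = subtree-++ y pos r e
subtree-++ (node _ _ o) (false ∷ pos) r e = subtree-++ o pos r e

subtree-child : ∀ (T : Tree n m) pos b {t y o} → subtree T pos ≡ just (node t y o) →
  subtree T (pos ++ b ∷ []) ≡ just (child b (node t y o))
subtree-child T pos true  e = subtree-++ T pos _ e
subtree-child T pos false e = subtree-++ T pos _ e

subtree-prefix : ∀ (T : Tree n m) pos r {V} → subtree T (pos ++ r) ≡ just V → ∃[ U ] subtree T pos ≡ just U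
subtree-prefix T            []            r e = T , refl
subtree-prefix (leaf _)     (_ ∷ _)       r ()
subtree-prefix (node _ y _) (true ∷ pos)  r e = subtree-prefix y pos r e
subtree-prefix (node _ _ o) (false ∷ pos) r e = subtree-prefix o pos r e

subtree-parent : ∀ (T : Tree n m) pos b {V} → subtree T (pos ++ b ∷ []) ≡ just V →
  ∃[ t ] ∃[ y ] ∃[ o ] subtree T pos ≡ just (node t y o)
subtree-parent (leaf _)     []            b ()
subtree-parent (node t y o) []            b _  = t , y , o , refl
subtree-parent (leaf _)     (_ ∷ _)       b ()
subtree-parent (node _ y _) (true ∷ pos)  b e = subtree-parent y pos b e
subtree-parent (node _ _ o) (false ∷ pos) b e = subtree-parent o pos b e

reaches-∷ʳ : ∀ (T : Tree n m) pos b q → reaches T (pos ++ b ∷ []) q ≡ reaches T pos q ∧ outSat T pos b q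
reaches-∷ʳ (leaf _)     []            b     q = refl
reaches-∷ʳ (node t _ _) []            true  q = ∧-identityʳ (sat t q)
reaches-∷ʳ (node t _ _) []            false q = ∧-identityʳ (not (sat t q))
reaches-∷ʳ (leaf _)     (_ ∷ _)       b     q = refl
reaches-∷ʳ (node t y _) (true ∷ pos)  b     q =
  trans (cong (sat t q ∧_) (reaches-∷ʳ y pos b q)) (sym (∧-assoc (sat t q) _ _))
reaches-∷ʳ (node t _ o) (false ∷ pos) b     q =
  trans (cong (not (sat t q) ∧_) (reaches-∷ʳ o pos b q)) (sym (∧-assoc (not (sat t q)) _ _))

reaches-++ : ∀ (T : Tree n m) pos r {V} q → subtree T pos ≡ just V →
  reaches T (pos ++ r) q ≡ reaches T pos q ∧ reaches V r q
reaches-++ T            []            r q refl = refl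
reaches-++ (leaf _)     (_ ∷ _)       r q ()
reaches-++ (node t y _) (true ∷ pos)  r q e =
  trans (cong (sat t q ∧_) (reaches-++ y pos r q e)) (sym (∧-assoc (sat t q) _ _))
reaches-++ (node t _ o) (false ∷ pos) r q e =
  trans (cong (not (sat t q) ∧_) (reaches-++ o pos r q e)) (sym (∧-assoc (not (sat t q)) _ _))

reaches-prefix : ∀ (T : Tree n m) pos r q → reaches T (pos ++ r) q ≡ true → reaches T pos q ≡ true
reaches-prefix T            []            r q _ = refl
reaches-prefix (leaf _)     (_ ∷ _)       r q ()
reaches-prefix (node t y _) (true ∷ pos)  r q h =
  cong₂ _∧_ (∧-conicalˡ _ _ h) (reaches-prefix y pos r q (∧-conicalʳ _ _ h))
reaches-prefix (node t _ o) (false ∷ pos) r q h =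
  cong₂ _∧_ (∧-conicalˡ _ _ h) (reaches-prefix o pos r q (∧-conicalʳ _ _ h))

reaches-prefix-false : ∀ (T : Tree n m) pos r q → reaches T pos q ≡ false → reaches T (pos ++ r) q ≡ false
reaches-prefix-false T pos r q h with reaches T (pos ++ r) q in e
... | false = refl
... | true  = trans (sym (reaches-prefix T pos r q e)) h

outSat-node : ∀ (T : Tree n m) pos {t y o} b q → subtree T pos ≡ just (node t y o) →
  outSat T pos b q ≡ outcome t b q
outSat-node (node t y o) []            true  q refl = refl
outSat-node (node t y o) []            false q refl = refl
outSat-node (leaf _)     (_ ∷ _)       b     q ()
outSat-node (node _ y _) (true ∷ pos)  b     q e = outSat-node y pos b q e
outSat-node (node _ _ o) (false ∷ pos) b     q e = outSat-node o pos b q e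

depth-child : ∀ (t : Test n) (y o : Tree n m) b q → outcome t b q ≡ true →
  depth (node t y o) q ≡ suc (depth (child b (node t y o)) q)
depth-child t y o true  q h rewrite h = refl
depth-child t y o false q h rewrite not-true h = refl

depth-graft : ∀ (t : Test n) (y o X : Tree n m) b q → outcome t b q ≡ true →
  depth (graft b (node t y o) X) q ≡ suc (depth X q)
depth-graft t y o X true  q h = depth-child t X o true q h
depth-graft t y o X false q h = depth-child t y X false q h

depth-graft-other : ∀ (t : Test n) (y o X : Tree n m) b q → outcome t (not b) q ≡ true →
  depth (graft b (node t y o) X) q ≡ suc (depth (child (not b) (node t y o)) q)
depth-graft-other t y o X true  q h = depth-child t X o false q h
depth-graft-other t y o X false q h = depth-child t y X true q h

depth-subtree : ∀ (T : Tree n m) pos {V} q → reaches T pos q ≡ true → subtree T pos ≡ just V →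
  depth T q ≡ length pos +ₙ depth V q
depth-subtree T            []            q _ refl = refl
depth-subtree (leaf _)     (_ ∷ _)       q () _
depth-subtree (node t y _) (true ∷ pos)  q r e rewrite ∧-conicalˡ (sat t q) _ r =
  cong suc (depth-subtree y pos q (∧-conicalʳ _ _ r) e)
depth-subtree (node t _ o) (false ∷ pos) q r e rewrite not-true (∧-conicalˡ (not (sat t q)) _ r) =
  cong suc (depth-subtree o pos q (∧-conicalʳ _ _ r) e)

replace : Tree n m → Pos → Tree n m → Tree n m
replace T            []            R = R
replace (leaf c)     (_ ∷ _)       R = leaf c
replace (node t y o) (true ∷ pos)  R = node t (replace y pos R) o
replace (node t y o) (false ∷ pos) R = node t y (replace o pos R)

subtree-replace : ∀ (T : Tree n m) pos R {U} → subtree T pos ≡ just U → subtree (replace T pos R) pos ≡ just R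
subtree-replace T            []            R _  = refl
subtree-replace (leaf _)     (_ ∷ _)       R ()
subtree-replace (node _ y _) (true ∷ pos)  R e = subtree-replace y pos R e
subtree-replace (node _ _ o) (false ∷ pos) R e = subtree-replace o pos R e

reaches-replace : ∀ (T : Tree n m) pos R {U} q → subtree T pos ≡ just U →
  reaches (replace T pos R) pos q ≡ reaches T pos q
reaches-replace T            []            R q _  = refl
reaches-replace (leaf _)     (_ ∷ _)       R q ()
reaches-replace (node t y _) (true ∷ pos)  R q e = cong (sat t q ∧_) (reaches-replace y pos R q e)
reaches-replace (node t _ o) (false ∷ pos) R q e = cong (not (sat t q) ∧_) (reaches-replace o pos R q e)

depth-replace-unreached : ∀ (T : Tree n m) pos R q → reaches T pos q ≡ false →
  depth (replace T pos R) q ≡ depth T q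
depth-replace-unreached T            []            R q ()
depth-replace-unreached (leaf _)     (_ ∷ _)       R q _ = refl
depth-replace-unreached (node t y _) (true ∷ pos)  R q h with sat t q
... | true  = cong suc (depth-replace-unreached y pos R q h)
... | false = refl
depth-replace-unreached (node t _ o) (false ∷ pos) R q h with sat t q
... | false = cong suc (depth-replace-unreached o pos R q h)
... | true  = refl

consistent-intro : ∀ (T : Tree n m) p₁ b₁ p₂ b₂ q →
  outSat T p₁ b₁ q ≡ true → outSat T p₂ b₂ q ≡ true → consistent T p₁ b₁ p₂ b₂ ≡ true
consistent-intro T p₁ b₁ p₂ b₂ q h₁ h₂ =
  Equivalence.to T-≡ (any⁺ _ (lose (∈-allFin q) (Equivalence.from T-≡ (cong₂ _∧_ h₁ h₂))))

consistent-elim : ∀ (T : Tree n m) p₁ b₁ p₂ b₂ → consistent T p₁ b₁ p₂ b₂ ≡ true →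
  ∃[ q ] outSat T p₁ b₁ q ≡ true × outSat T p₂ b₂ q ≡ true
consistent-elim {n} T p₁ b₁ p₂ b₂ h with satisfied (any⁻ _ (allFin n) (Equivalence.from T-≡ h))
... | q , both = q , ∧-conicalˡ _ _ (Equivalence.to T-≡ both) , ∧-conicalʳ (outSat T p₁ b₁ q) _ (Equivalence.to T-≡ both)

-- Validity of rearranged trees

Covers : (Fin m → Subset n) → (Fin n → Bool) → Tree n m → Set
Covers C F V = ∀ pos c → subtree V pos ≡ just (leaf c) → ∀ q → F q ≡ true → reaches V pos q ≡ true → q ∈ C c

module _ {C : Fin m → Subset n} where

  covers-weaken : ∀ {F G V} → (∀ q → G q ≡ true → F q ≡ true) → Covers C F V → Covers C G V
  covers-weaken G⊆F cov pos c e q Gq = cov pos c e q (G⊆F q Gq)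

  covers-node : ∀ {F F₁ F₂ t y o} →
    (∀ q → F q ≡ true → sat t q ≡ true → F₁ q ≡ true) →
    (∀ q → F q ≡ true → sat t q ≡ false → F₂ q ≡ true) →
    Covers C F₁ y → Covers C F₂ o → Covers C F (node t y o)
  covers-node {t = t} yes-side no-side cov₁ cov₂ (true ∷ pos) c e q Fq r =
    cov₁ pos c e q (yes-side q Fq (∧-conicalˡ (sat t q) _ r)) (∧-conicalʳ (sat t q) _ r)
  covers-node {t = t} yes-side no-side cov₁ cov₂ (false ∷ pos) c e q Fq r =
    cov₂ pos c e q (no-side q Fq (not-true (∧-conicalˡ (not (sat t q)) _ r))) (∧-conicalʳ (not (sat t q)) _ r)

  covers-graft : ∀ {F F₁ F₂ t y o X} b →
    (∀ q → F q ≡ true → outcome t b q ≡ true → F₁ q ≡ true) →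
    (∀ q → F q ≡ true → outcome t (not b) q ≡ true → F₂ q ≡ true) →
    Covers C F₁ X → Covers C F₂ (child (not b) (node t y o)) → Covers C F (graft b (node t y o) X)
  covers-graft true  this other covX cov = covers-node this (λ q Fq s → other q Fq (cong not s)) covX cov
  covers-graft false this other covX cov = covers-node (λ q Fq s → other q Fq s) (λ q Fq s → this q Fq (cong not s)) cov covX

  covers-subtree : ∀ {F} (T : Tree n m) pos {V} → Covers C F T → subtree T pos ≡ just V →
    Covers C (λ q → F q ∧ reaches T pos q) V
  covers-subtree {F} T pos cov e pos′ c e′ q Fq r =
    cov (pos ++ pos′) c (trans (subtree-++ T pos pos′ e) e′) q (∧-conicalˡ (F q) _ Fq)
      (trans (reaches-++ T pos pos′ q e) (cong₂ _∧_ (∧-conicalʳ (F q) _ Fq) r))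

  covers-replace : ∀ {F} (T : Tree n m) pos R → Covers C F T → Covers C (λ q → F q ∧ reaches T pos q) R →
    Covers C F (replace T pos R)
  covers-replace {F} T [] R covT covR = covers-weaken (λ q Fq → trans (∧-identityʳ (F q)) Fq) covR
  covers-replace (leaf _) (_ ∷ _) R covT covR = covT
  covers-replace {F} (node t y o) (true ∷ pos) R covT covR (true ∷ pos′) c e q Fq r =
    covers-replace {λ q → F q ∧ sat t q} y pos R
      (λ pos″ c′ e′ q′ h r′ → covT (true ∷ pos″) c′ e′ q′ (∧-conicalˡ (F q′) _ h) (cong₂ _∧_ (∧-conicalʳ (F q′) _ h) r′))
      (covers-weaken (λ q′ h → trans (sym (∧-assoc (F q′) _ _)) h) covR)
      pos′ c e q (cong₂ _∧_ Fq (∧-conicalˡ (sat t q) _ r)) (∧-conicalʳ (sat t q) _ r)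
  covers-replace (node t y o) (true ∷ pos) R covT covR (false ∷ pos′) = covT (false ∷ pos′)
  covers-replace (node t y o) (false ∷ pos) R covT covR (true ∷ pos′) = covT (true ∷ pos′)
  covers-replace {F} (node t y o) (false ∷ pos) R covT covR (false ∷ pos′) c e q Fq r =
    covers-replace {λ q → F q ∧ not (sat t q)} o pos R
      (λ pos″ c′ e′ q′ h r′ → covT (false ∷ pos″) c′ e′ q′ (∧-conicalˡ (F q′) _ h) (cong₂ _∧_ (∧-conicalʳ (F q′) _ h) r′))
      (covers-weaken (λ q′ h → trans (sym (∧-assoc (F q′) _ _)) h) covR)
      pos′ c e q (cong₂ _∧_ Fq (∧-conicalˡ (not (sat t q)) _ r)) (∧-conicalʳ (not (sat t q)) _ r)

allowed-subtree : ∀ {K : Subset n} (T : Tree n m) pos {V} → AllowedTests K T → subtree T pos ≡ just V → AllowedTests K V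
allowed-subtree T            []            a refl = a
allowed-subtree (leaf _)     (_ ∷ _)       a ()
allowed-subtree (node _ y _) (true ∷ pos)  (_ , ay , _) e = allowed-subtree y pos ay e
allowed-subtree (node _ _ o) (false ∷ pos) (_ , _ , ao) e = allowed-subtree o pos ao e

allowed-replace : ∀ {K : Subset n} (T : Tree n m) pos R → AllowedTests K T → AllowedTests K R → AllowedTests K (replace T pos R)
allowed-replace T            []            R a            aR = aR
allowed-replace (leaf _)     (_ ∷ _)       R a            aR = a
allowed-replace (node t y o) (true ∷ pos)  R (at , ay , ao) aR = at , allowed-replace y pos R ay aR , ao
allowed-replace (node t y o) (false ∷ pos) R (at , ay , ao) aR = at , ay , allowed-replace o pos R ao aR

allowed-graft : ∀ {K : Subset n} b (V X : Tree n m) → AllowedTests K V → AllowedTests K X → AllowedTests K (graft b V X)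
allowed-graft true  (node t y o) X (at , _ , ao) aX = at , aX , ao
allowed-graft false (node t y o) X (at , ay , _) aX = at , ay , aX
allowed-graft true  (leaf _)     X _             aX = aX
allowed-graft false (leaf _)     X _             aX = aX

take-suc-nth : ∀ (d : List Bool) i → i <ₙ length d → take (suc i) d ≡ take i d ++ nth d i ∷ []
take-suc-nth (x ∷ d) zero    _           = refl
take-suc-nth (x ∷ d) (suc i) (s≤s i<∣d∣) = cong (x ∷_) (take-suc-nth d i i<∣d∣)

-- The path and its rearrangement

-- v i is the paper's u_{i+1}, so the path has j = suc k edges, v k is u_j
-- (the pivot whose test is moved up to u₁) and exit i is u′_{i+2}.
module Path {n m} (T : Tree n m) (p d : List Bool) (k : ℕ) (len : length d ≡ suc k)
            (bottom : IsNode T (p ++ take (suc k) d)) where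

  v : ℕ → Pos
  v i = p ++ take i d

  fuel⇒< : ∀ {s f} → s +ₙ suc f ≡ k → s <ₙ k
  fuel⇒< {s} e = subst (s <ₙ_) e (ℕₚ.m<m+n s (s≤s z≤n))

  D : ℕ → Bool
  D = nth d

  exit : ℕ → Pos
  exit i = v i ++ not (D i) ∷ []

  v-suc : ∀ {i} → i ≤ₙ k → v (suc i) ≡ v i ++ D i ∷ []
  v-suc {i} i≤k =
    trans (cong (p ++_) (take-suc-nth d i (subst (i <ₙ_) (sym len) (s≤s i≤k))))
          (sym (Listₚ.++-assoc p (take i d) _))

  length-v : ∀ {i} → i ≤ₙ suc k → length (v i) ≡ length p +ₙ i
  length-v {i} i≤1+k =
    trans (Listₚ.length-++ p)
          (cong (length p +ₙ_) (trans (Listₚ.length-take i d) (ℕₚ.m≤n⇒m⊓n≡m (subst (i ≤ₙ_) (sym len) i≤1+k))))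

  v-isNode : ∀ {i} → i ≤ₙ suc k → ∃[ V ] subtree T (v i) ≡ just V
  v-isNode {i} i≤1+k = above-bottom (suc k ∸ i) i (ℕₚ.m∸n+n≡m i≤1+k)
    where
    above-bottom : ∀ f i → f +ₙ i ≡ suc k → ∃[ V ] subtree T (v i) ≡ just V
    above-bottom zero    i refl = isJust⇒≡just bottom
    above-bottom (suc f) i e with above-bottom f (suc i) (trans (ℕₚ.+-suc f i) e)
    ... | _ , e′ = subtree-prefix T (v i) (D i ∷ [])
                     (trans (cong (subtree T) (sym (v-suc (subst (i ≤ₙ_) (ℕₚ.suc-injective e) (ℕₚ.m≤n+m i f))))) e′)

  v-internal : ∀ {i} → i ≤ₙ k → ∃[ t ] ∃[ y ] ∃[ o ] subtree T (v i) ≡ just (node t y o)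
  v-internal {i} i≤k with v-isNode (s≤s i≤k)
  ... | _ , e = subtree-parent T (v i) (D i) (trans (cong (subtree T) (sym (v-suc i≤k))) e)

  test : ∀ {i} → i ≤ₙ k → Test n
  test i≤k = proj₁ (v-internal i≤k)

  pivotTest : Test n
  pivotTest = test (ℕₚ.≤-refl {k})

  outSat-v : ∀ {i} (i≤k : i ≤ₙ k) b q → outSat T (v i) b q ≡ outcome (test i≤k) b q
  outSat-v i≤k b q = outSat-node T _ b q (proj₂ (proj₂ (proj₂ (v-internal i≤k))))

  outSat-v-not : ∀ {i} b q → i ≤ₙ k → outSat T (v i) (not b) q ≡ not (outSat T (v i) b q)
  outSat-v-not b q i≤k =
    trans (outSat-v i≤k (not b) q) (trans (outcome-not (test i≤k) b q) (cong not (sym (outSat-v i≤k b q))))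

  -- T is a junk value at positions that are not nodes.
  subtreeAt : Pos → Tree n m
  subtreeAt pos = fromMaybe T (subtree T pos)

  depth-below-v : ∀ {i} c q → i ≤ₙ k → reaches T (v i ++ c ∷ []) q ≡ true →
    depth T q ≡ length p +ₙ suc i +ₙ depth (subtreeAt (v i ++ c ∷ [])) q
  depth-below-v {i} c q i≤k r with v-internal i≤k
  ... | t , y , o , e = begin
    depth T q
      ≡⟨ depth-subtree T (v i ++ c ∷ []) q r (subtree-child T (v i) c e) ⟩
    length (v i ++ c ∷ []) +ₙ depth (child c (node t y o)) q
      ≡⟨ cong₂ _+ₙ_ (trans (Listₚ.length-++ (v i)) (cong (_+ₙ 1) (length-v (ℕₚ.m≤n⇒m≤1+n i≤k))))
                    (cong (λ V → depth (fromMaybe T V) q) (sym (subtree-child T (v i) c e))) ⟩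
    length p +ₙ i +ₙ 1 +ₙ depth (subtreeAt (v i ++ c ∷ [])) q
      ≡⟨ cong (_+ₙ depth (subtreeAt (v i ++ c ∷ [])) q) (trans (ℕₚ.+-assoc (length p) i 1) (cong (length p +ₙ_) (ℕₚ.+-comm i 1))) ⟩
    length p +ₙ suc i +ₙ depth (subtreeAt (v i ++ c ∷ [])) q ∎
    where open ≡-Reasoning

  reaches-v-suc : ∀ {i} q → i ≤ₙ k → reaches T (v (suc i)) q ≡ reaches T (v i) q ∧ outSat T (v i) (D i) q
  reaches-v-suc {i} q i≤k = trans (cong (λ x → reaches T x q) (v-suc i≤k)) (reaches-∷ʳ T (v i) (D i) q)

  Follows : Fin n → ℕ → Set
  Follows q i = ∀ s → s <ₙ i → outSat T (v s) (D s) q ≡ true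

  reaches-v⇒follows : ∀ {i} q → i ≤ₙ suc k → reaches T (v i) q ≡ true → Follows q i
  reaches-v⇒follows {suc i} q (s≤s i≤k) r s s<1+i
    with trans (sym (reaches-v-suc q i≤k)) r | ℕₚ.m<1+n⇒m<n∨m≡n s<1+i
  ... | r′ | inj₁ s<i  = reaches-v⇒follows q (ℕₚ.m≤n⇒m≤1+n i≤k) (∧-conicalˡ _ _ r′) s s<i
  ... | r′ | inj₂ refl = ∧-conicalʳ (reaches T (v s) q) _ r′

  exit-reached : ∀ {i} q → i ≤ₙ k → reaches T (exit i) q ≡ true → Follows q i × outSat T (v i) (not (D i)) q ≡ true
  exit-reached {i} q i≤k r =
    reaches-v⇒follows q (ℕₚ.m≤n⇒m≤1+n i≤k) (∧-conicalˡ _ _ r′) , ∧-conicalʳ (reaches T (v i) q) _ r′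
    where r′ = trans (sym (reaches-∷ʳ T (v i) (not (D i)) q)) r

  ¬follows-past-exit : ∀ {i s} q → i <ₙ s → s ≤ₙ suc k → Follows q s → outSat T (v i) (not (D i)) q ≡ true → ⊥
  ¬follows-past-exit {i} q i<s s≤1+k fol leaves
    with () ← trans (sym leaves) (trans (outSat-v-not (D i) q (ℕₚ.≤-pred (ℕₚ.≤-trans i<s s≤1+k))) (cong not (fol i i<s)))

  exits-unique : ∀ {i i′} q → i ≤ₙ k → i′ ≤ₙ k → reaches T (exit i) q ≡ true → reaches T (exit i′) q ≡ true → i ≡ i′
  exits-unique {i} {i′} q i≤k i′≤k r r′ with exit-reached q i≤k r | exit-reached q i′≤k r′ | ℕₚ.<-cmp i i′
  ... | _ , leaves | fol′ , _      | tri< i<i′ _ _ = ⊥-elim (¬follows-past-exit q i<i′ (ℕₚ.m≤n⇒m≤1+n i′≤k) fol′ leaves)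
  ... | _          | _             | tri≈ _ i≡i′ _ = i≡i′
  ... | fol , _    | _ , leaves′   | tri> _ _ i′<i = ⊥-elim (¬follows-past-exit q i′<i (ℕₚ.m≤n⇒m≤1+n i≤k) fol leaves′)

  exit-misses-bottom : ∀ {i} q → i ≤ₙ k → reaches T (exit i) q ≡ true → reaches T (v (suc k)) q ≡ false
  exit-misses-bottom q i≤k r with reaches T (v (suc k)) q in r-bottom
  ... | false = refl
  ... | true  = ⊥-elim (¬follows-past-exit q (s≤s i≤k) ℕₚ.≤-refl (reaches-v⇒follows q ℕₚ.≤-refl r-bottom) (proj₂ (exit-reached q i≤k r)))

  bottom-misses-exit : ∀ {i} q → i ≤ₙ k → reaches T (v (suc k)) q ≡ true → reaches T (exit i) q ≡ false
  bottom-misses-exit {i} q i≤k r with reaches T (exit i) q in r-exit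
  ... | false = refl
  ... | true  with () ← trans (sym r) (exit-misses-bottom q i≤k r-exit)

  exit-misses-exit : ∀ {i i′} q → i ≤ₙ k → i′ ≤ₙ k → i′ ≢ i → reaches T (exit i) q ≡ true → reaches T (exit i′) q ≡ false
  exit-misses-exit {i} {i′} q i≤k i′≤k i′≢i r with reaches T (exit i′) q in r′
  ... | false = refl
  ... | true  = ⊥-elim (i′≢i (exits-unique q i′≤k i≤k r′ r))

  bottom-or-exit : ∀ q → reaches T p q ≡ true → reaches T (v (suc k)) q ≡ true ⊎ ∃[ i ] i ≤ₙ k × reaches T (exit i) q ≡ true
  bottom-or-exit q r = walk (suc k) ℕₚ.≤-refl
    where
    walk : ∀ i → i ≤ₙ suc k → reaches T (v i) q ≡ true ⊎ ∃[ s ] s ≤ₙ k × reaches T (exit s) q ≡ true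
    walk zero    _         = inj₁ (trans (cong (λ x → reaches T x q) (Listₚ.++-identityʳ p)) r)
    walk (suc i) (s≤s i≤k) with walk i (ℕₚ.m≤n⇒m≤1+n i≤k)
    ... | inj₂ exits = inj₂ exits
    ... | inj₁ rᵢ with outSat T (v i) (D i) q in dir
    ...   | true  = inj₁ (trans (reaches-v-suc q i≤k) (cong₂ _∧_ rᵢ dir))
    ...   | false = inj₂ (i , i≤k , trans (reaches-∷ʳ T (v i) (not (D i)) q)
                                          (cong₂ _∧_ rᵢ (trans (outSat-v-not (D i) q i≤k) (cong not dir))))

  consistentWithPivot : ℕ → Bool → Bool
  consistentWithPivot s b = consistent T (v s) (not (D s)) (v k) b

  module _ {C : Fin m → Subset n} (irr : Irreducible C T) where

    -- Irreducibility gives queries through both children of the pivot; they all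
    -- follow the path above it, so the pivot test splits the path side of every
    -- earlier test and cannot also split its exit side.
    ¬consistent-with-both-outcomes : ∀ {s} → s <ₙ k → consistentWithPivot s true ≡ true → consistentWithPivot s false ≡ true → ⊥
    ¬consistent-with-both-outcomes {s} s<k c-yes c-no = ¬separates-both-sides tₛ tₖ (D s) path-side exit-side
      where
      s≤k : s ≤ₙ k
      s≤k = ℕₚ.<⇒≤ s<k
      tₛ tₖ : Test n
      tₛ = test s≤k
      tₖ = pivotTest
      separated : ∀ A → (∀ b → ∃[ q ] A q ≡ true × outcome tₖ b q ≡ true) → Separates tₖ A
      separated A witness with witness true | witness false
      ... | q , a , yes-q | q′ , a′ , no-q′ = q , q′ , a , a′ , yes-q , not-true no-q′
      path-side : Separates tₖ (outcome tₛ (D s))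
      path-side = separated _ λ b → pivot-child b (v-internal ℕₚ.≤-refl)
        where
        pivot-child : ∀ b → (∃[ t ] ∃[ y ] ∃[ o ] subtree T (v k) ≡ just (node t y o)) →
          ∃[ q ] outcome tₛ (D s) q ≡ true × outcome tₖ b q ≡ true
        pivot-child b (_ , _ , _ , e) with proj₁ (irr (v k ++ b ∷ []) (≡just⇒isJust (subtree-child T (v k) b e)))
        ... | q , r with trans (sym (reaches-∷ʳ T (v k) b q)) r
        ...   | r′ = q , trans (sym (outSat-v s≤k (D s) q)) (reaches-v⇒follows q (ℕₚ.n≤1+n k) (∧-conicalˡ _ _ r′) s s<k)
                       , trans (sym (outSat-v ℕₚ.≤-refl b q)) (∧-conicalʳ (reaches T (v k) q) _ r′)
      exit-side : Separates tₖ (outcome tₛ (not (D s)))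
      exit-side = separated _ λ b → exit-query b (consistent-both b)
        where
        consistent-both : ∀ b → consistentWithPivot s b ≡ true
        consistent-both true  = c-yes
        consistent-both false = c-no
        exit-query : ∀ b → consistentWithPivot s b ≡ true → ∃[ q ] outcome tₛ (not (D s)) q ≡ true × outcome tₖ b q ≡ true
        exit-query b c with consistent-elim T _ _ _ _ c
        ... | q , h₁ , h₂ = q , trans (sym (outSat-v s≤k _ q)) h₁ , trans (sym (outSat-v ℕₚ.≤-refl b q)) h₂

    consistentWithPivot-exclusive : ∀ {s} b → s <ₙ k → consistentWithPivot s b ≡ true → consistentWithPivot s (not b) ≡ false
    consistentWithPivot-exclusive {s} b s<k c with consistentWithPivot s (not b) in c′
    ... | false = refl
    ... | true  = ⊥-elim (both-sides b c c′)
      where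
      both-sides : ∀ b → consistentWithPivot s b ≡ true → consistentWithPivot s (not b) ≡ true → ⊥
      both-sides true  c c′ = ¬consistent-with-both-outcomes s<k c c′
      both-sides false c c′ = ¬consistent-with-both-outcomes s<k c′ c

  prune : Bool → ℕ → ℕ → Tree n m
  prune b s zero    = subtreeAt (v s ++ b ∷ [])
  prune b s (suc f) = if consistentWithPivot s b
                      then graft (D s) (subtreeAt (v s)) (prune b (suc s) f)
                      else prune b (suc s) f

  rearranged : Tree n m
  rearranged = node pivotTest (prune true 0 k) (prune false 0 k)

  T′ : Tree n m
  T′ = replace T p rearranged

  kept : Bool → ℕ → ℕ
  kept b = count (λ s → consistentWithPivot s b)

  prune-step : ∀ b s f q → s <ₙ k → outSat T (v s) (D s) q ≡ true →
    depth (prune b s (suc f)) q +ₙ kept b s ≡ depth (prune b (suc s) f) q +ₙ kept b (suc s)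
  prune-step b s f q s<k dir with consistentWithPivot s b | v-internal (ℕₚ.<⇒≤ s<k)
  ... | false | _ = cong (depth (prune b (suc s) f) q +ₙ_) (sym (ℕₚ.+-identityʳ (kept b s)))
  ... | true  | t , y , o , e = begin
    depth (graft (D s) (subtreeAt (v s)) X) q +ₙ kept b s
      ≡⟨ cong (λ V → depth (graft (D s) (fromMaybe T V) X) q +ₙ kept b s) e ⟩
    depth (graft (D s) (node t y o) X) q +ₙ kept b s
      ≡⟨ cong (_+ₙ kept b s) (depth-graft t y o X (D s) q (trans (sym (outSat-node T (v s) (D s) q e)) dir)) ⟩
    suc (depth X q) +ₙ kept b s
      ≡⟨ trans (sym (ℕₚ.+-suc (depth X q) (kept b s))) (cong (depth X q +ₙ_) (ℕₚ.+-comm 1 (kept b s))) ⟩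
    depth X q +ₙ (kept b s +ₙ 1) ∎
    where
    open ≡-Reasoning
    X : Tree n m
    X = prune b (suc s) f

  prune-depth-through : ∀ b f s q → s +ₙ f ≡ k → Follows q k →
    depth (prune b s f) q +ₙ kept b s ≡ depth (subtreeAt (v k ++ b ∷ [])) q +ₙ kept b k
  prune-depth-through b zero s q e fol with refl ← trans (sym (ℕₚ.+-identityʳ s)) e = refl
  prune-depth-through b (suc f) s q e fol =
    trans (prune-step b s f q (fuel⇒< e) (fol s (fuel⇒< e)))
          (prune-depth-through b f (suc s) q (trans (sym (ℕₚ.+-suc s f)) e) fol)

  prune-depth-exit : ∀ b f s {i} q → s +ₙ f ≡ k → s ≤ₙ i → i <ₙ k → Follows q i →
    outSat T (v i) (not (D i)) q ≡ true → consistentWithPivot i b ≡ true →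
    depth (prune b s f) q +ₙ kept b s ≡ suc (depth (subtreeAt (exit i)) q) +ₙ kept b i
  prune-depth-exit b zero s q e s≤i i<k _ _ _ with refl ← trans (sym (ℕₚ.+-identityʳ s)) e =
    ⊥-elim (ℕₚ.<-irrefl refl (ℕₚ.≤-<-trans s≤i i<k))
  prune-depth-exit b (suc f) s q e s≤i i<k fol leaves c with ℕₚ.m≤n⇒m<n∨m≡n s≤i
  ... | inj₁ s<i  = trans (prune-step b s f q (ℕₚ.<-trans s<i i<k) (fol s s<i))
                          (prune-depth-exit b f (suc s) q (trans (sym (ℕₚ.+-suc s f)) e) s<i i<k fol leaves c)
  ... | inj₂ refl = cong (_+ₙ kept b s) (exit-here (v-internal (ℕₚ.<⇒≤ i<k)))
    where
    exit-here : (∃[ t ] ∃[ y ] ∃[ o ] subtree T (v s) ≡ just (node t y o)) →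
      depth (prune b s (suc f)) q ≡ suc (depth (subtreeAt (exit s)) q)
    exit-here (t , y , o , e) rewrite c | e | subtree-child T (v s) (not (D s)) e =
      depth-graft-other t y o _ (D s) q (trans (sym (outSat-node T (v s) (not (D s)) q e)) leaves)

  reaches-v0 : ∀ q → reaches T p q ≡ true → reaches T (v 0) q ≡ true
  reaches-v0 q r = trans (cong (λ x → reaches T x q) (Listₚ.++-identityʳ p)) r

  depth-T′-inside : ∀ q → reaches T p q ≡ true → depth T′ q ≡ length p +ₙ suc (depth (prune (sat pivotTest q) 0 k) q)
  depth-T′-inside q r with subtree-prefix T p (take (suc k) d) (proj₂ (isJust⇒≡just bottom))
  ... | _ , e = begin
    depth T′ q
      ≡⟨ depth-subtree T′ p q (trans (reaches-replace T p rearranged q e) r) (subtree-replace T p rearranged e) ⟩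
    length p +ₙ depth rearranged q
      ≡⟨ cong (length p +ₙ_) (depth-child pivotTest _ _ (sat pivotTest q) q (outcome-sat pivotTest q)) ⟩
    length p +ₙ suc (depth (child (sat pivotTest q) rearranged) q)
      ≡⟨ cong (λ x → length p +ₙ suc (depth x q)) (child-rearranged (sat pivotTest q)) ⟩
    length p +ₙ suc (depth (prune (sat pivotTest q) 0 k) q) ∎
    where
    open ≡-Reasoning
    child-rearranged : ∀ b → child b rearranged ≡ prune b 0 k
    child-rearranged true  = refl
    child-rearranged false = refl

  depth-T′-outside : ∀ q → reaches T p q ≡ false → depth T′ q ≡ depth T q
  depth-T′-outside q r = depth-replace-unreached T p rearranged q r

  dropped-follows : ∀ {s b} q → s ≤ₙ k → consistentWithPivot s b ≡ false → outSat T (v k) b q ≡ true →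
    outSat T (v s) (D s) q ≡ true
  dropped-follows {s} {b} q s≤k c pivot-b with outSat T (v s) (not (D s)) q in leaves
  ... | true  with () ← trans (sym (consistent-intro T (v s) (not (D s)) (v k) b q leaves pivot-b)) c
  ... | false = trans (sym (not-involutive _)) (trans (cong not (sym (outSat-v-not (D s) q s≤k))) (cong not leaves))

  module _ {C : Fin m → Subset n} {K : Subset n} (valid : IsDecisionTree C K T) where

    private
      covers-T : Covers C (λ _ → true) T
      covers-T pos c e q _ = proj₂ valid pos c e q

      allowed-subtreeAt : ∀ pos → AllowedTests K (subtreeAt pos)
      allowed-subtreeAt pos with subtree T pos in e
      ... | just _  = allowed-subtree T pos (proj₁ valid) e
      ... | nothing = proj₁ valid

    allowed-prune : ∀ b s f → AllowedTests K (prune b s f)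
    allowed-prune b s zero    = allowed-subtreeAt (v s ++ b ∷ [])
    allowed-prune b s (suc f) with consistentWithPivot s b
    ... | true  = allowed-graft (D s) _ _ (allowed-subtreeAt (v s)) (allowed-prune b (suc s) f)
    ... | false = allowed-prune b (suc s) f

    covers-prune : ∀ b f s (G : Fin n → Bool) → s +ₙ f ≡ k →
      (∀ q → G q ≡ true → reaches T (v s) q ≡ true) → (∀ q → G q ≡ true → outSat T (v k) b q ≡ true) →
      Covers C G (prune b s f)
    covers-prune b zero s G e reach pivot-b with refl ← trans (sym (ℕₚ.+-identityʳ s)) e | v-internal (ℕₚ.≤-refl {s})
    ... | t , y , o , e′ rewrite subtree-child T (v s) b e′ =
      covers-weaken (λ q Gq → trans (reaches-∷ʳ T (v s) b q) (cong₂ _∧_ (reach q Gq) (pivot-b q Gq)))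
        (covers-subtree T (v s ++ b ∷ []) covers-T (subtree-child T (v s) b e′))
    covers-prune b (suc f) s G e reach pivot-b with consistentWithPivot s b in c | v-internal (ℕₚ.<⇒≤ (fuel⇒< e))
    ... | true  | t , y , o , e′ rewrite e′ =
      covers-graft (D s) (λ q Gq dir → cong₂ _∧_ Gq dir)
        (λ q Gq leaves → trans (reaches-∷ʳ T (v s) (not (D s)) q)
                               (cong₂ _∧_ (reach q Gq) (trans (outSat-node T (v s) (not (D s)) q e′) leaves)))
        (covers-prune b f (suc s) _ (trans (sym (ℕₚ.+-suc s f)) e)
          (λ q h → trans (reaches-v-suc q (ℕₚ.<⇒≤ (fuel⇒< e)))
                         (cong₂ _∧_ (reach q (∧-conicalˡ _ _ h)) (trans (outSat-node T (v s) (D s) q e′) (∧-conicalʳ (G q) _ h))))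
          (λ q h → pivot-b q (∧-conicalˡ _ _ h)))
        (covers-subtree T (exit s) covers-T (subtree-child T (v s) (not (D s)) e′))
    ... | false | _ =
      covers-prune b f (suc s) G (trans (sym (ℕₚ.+-suc s f)) e)
        (λ q Gq → trans (reaches-v-suc q (ℕₚ.<⇒≤ (fuel⇒< e))) (cong₂ _∧_ (reach q Gq) (dropped-follows q (ℕₚ.<⇒≤ (fuel⇒< e)) c (pivot-b q Gq))))
        pivot-b

    T′-isDecisionTree : IsDecisionTree C K T′
    T′-isDecisionTree =
      allowed-replace T p rearranged (proj₁ valid)
        (proj₁ (allowed-subtree T (v k) (proj₁ valid) (proj₂ (proj₂ (proj₂ (v-internal ℕₚ.≤-refl))))) ,
         allowed-prune true 0 k , allowed-prune false 0 k) ,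
      λ pos c e q → covers-replace T p rearranged covers-T covers-rearranged pos c e q refl
      where
      covers-rearranged : Covers C (λ q → true ∧ reaches T p q) rearranged
      covers-rearranged =
        covers-node (λ q r s → cong₂ _∧_ r s) (λ q r s → cong₂ _∧_ r (cong not s))
          (covers-prune true k 0 _ refl (λ q h → reaches-v0 q (∧-conicalˡ _ _ h))
            (λ q h → trans (outSat-v ℕₚ.≤-refl true q) (∧-conicalʳ (reaches T p q) _ h)))
          (covers-prune false k 0 _ refl (λ q h → reaches-v0 q (∧-conicalˡ _ _ h))
            (λ q h → trans (outSat-v ℕₚ.≤-refl false q) (∧-conicalʳ (reaches T p q) _ h)))

  pivot-outcome : ∀ q → outSat T (v k) (sat pivotTest q) q ≡ true
  pivot-outcome q = trans (outSat-v ℕₚ.≤-refl _ q) (outcome-sat pivotTest q)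

  depth-T′-through : ∀ q → reaches T p q ≡ true → Follows q k →
    depth T′ q ≡ length p +ₙ suc (kept (sat pivotTest q) k +ₙ (0 +ₙ depth (subtreeAt (v k ++ sat pivotTest q ∷ [])) q))
  depth-T′-through q r fol = trans (depth-T′-inside q r) (cong (λ x → length p +ₙ suc x) (begin
    depth (prune b 0 k) q                       ≡⟨ sym (ℕₚ.+-identityʳ _) ⟩
    depth (prune b 0 k) q +ₙ 0                  ≡⟨ prune-depth-through b k 0 q refl fol ⟩
    depth (subtreeAt (v k ++ b ∷ [])) q +ₙ kept b k ≡⟨ ℕₚ.+-comm _ (kept b k) ⟩
    kept b k +ₙ depth (subtreeAt (v k ++ b ∷ [])) q ∎))
    where
    open ≡-Reasoning
    b : Bool
    b = sat pivotTest q

  depth-T′-exit : ∀ {i} q → reaches T p q ≡ true → i <ₙ k → reaches T (exit i) q ≡ true →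
    depth T′ q ≡ length p +ₙ suc (kept (sat pivotTest q) i +ₙ (1 +ₙ depth (subtreeAt (exit i)) q))
  depth-T′-exit {i} q r i<k r-exit with exit-reached q (ℕₚ.<⇒≤ i<k) r-exit
  ... | fol , leaves = trans (depth-T′-inside q r) (cong (λ x → length p +ₙ suc x) (begin
    depth (prune b 0 k) q                          ≡⟨ sym (ℕₚ.+-identityʳ _) ⟩
    depth (prune b 0 k) q +ₙ 0                     ≡⟨ prune-depth-exit b k 0 q refl z≤n i<k fol leaves
                                                         (consistent-intro T (v i) (not (D i)) (v k) b q leaves (pivot-outcome q)) ⟩
    suc (depth (subtreeAt (exit i)) q) +ₙ kept b i ≡⟨ ℕₚ.+-comm _ (kept b i) ⟩
    kept b i +ₙ suc (depth (subtreeAt (exit i)) q) ∎))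
    where
    open ≡-Reasoning
    b : Bool
    b = sat pivotTest q

  module Accounting (w : Fin n → ℚ) (w≥0 : ∀ q → 0ℚ ≤ w q) {C : Fin m → Subset n} (irr : Irreducible C T) where

    indicator : Pos → Fin n → ℚ
    indicator pos q = if reaches T pos q then w q else 0ℚ

    indicator-hit : ∀ pos q → reaches T pos q ≡ true → indicator pos q ≡ w q
    indicator-hit pos q r rewrite r = refl

    indicator-miss : ∀ pos q → reaches T pos q ≡ false → indicator pos q ≡ 0ℚ
    indicator-miss pos q r rewrite r = refl

    indicator-nonNeg : ∀ pos q → 0ℚ ≤ indicator pos q
    indicator-nonNeg pos q with reaches T pos q
    ... | true  = w≥0 q
    ... | false = ℚₚ.≤-refl

    β : ℕ
    β = beta T p d (suc k)

    β≡kept : β ≡ kept (D k) k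
    β≡kept = countRange-from-1 _ k

    coefficient : ℕ → ℚ
    coefficient i = ℕtoℚ (delta T p d (suc k) (i ∸ 1)) - 1ℚ

    exits-share : Fin n → ℚ
    exits-share q = sumRange 3 (suc k) (λ i → coefficient i * indicator (sibling p d i) q)

    share : Fin n → ℚ
    share q = (ℕtoℚ k - ℕtoℚ β) * indicator (v (suc k)) q + ℕtoℚ β * indicator (exit k) q + exits-share q

    lhs : ℚ
    lhs = (ℕtoℚ k - ℕtoℚ β) * weight w T (v (suc k)) + ℕtoℚ β * weight w T (exit k)
          + sumRange 3 (suc k) (λ i → coefficient i * weight w T (sibling p d i))

    sum-share : sumFin share ≡ lhs
    sum-share = begin
      sumFin share
        ≡⟨ sumFin-+ (λ q → A * indicator (v (suc k)) q + ℕtoℚ β * indicator (exit k) q) exits-share ⟩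
      sumFin (λ q → A * indicator (v (suc k)) q + ℕtoℚ β * indicator (exit k) q) + sumFin exits-share
        ≡⟨ cong₂ _+_ (trans (sumFin-+ (λ q → A * indicator (v (suc k)) q) (λ q → ℕtoℚ β * indicator (exit k) q))
                            (cong₂ _+_ (sumFin-* A (indicator (v (suc k)))) (sumFin-* (ℕtoℚ β) (indicator (exit k)))))
                     (trans (sumFin-sumRange 3 (suc k) (λ i q → coefficient i * indicator (sibling p d i) q))
                            (sumRange-cong 3 (suc k) (λ i → sumFin-* (coefficient i) (indicator (sibling p d i))))) ⟩
      A * weight w T (v (suc k)) + ℕtoℚ β * weight w T (exit k)
        + sumRange 3 (suc k) (λ i → coefficient i * weight w T (sibling p d i)) ∎
      where
      open ≡-Reasoning
      A : ℚ
      A = ℕtoℚ k - ℕtoℚ β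

    share-≡ : ∀ q {x y z} → indicator (v (suc k)) q ≡ x → indicator (exit k) q ≡ y → exits-share q ≡ z →
      share q ≡ (ℕtoℚ k - ℕtoℚ β) * x + ℕtoℚ β * y + z
    share-≡ q ex ey ez = cong₂ _+_ (cong₂ _+_ (cong ((ℕtoℚ k - ℕtoℚ β) *_) ex) (cong (ℕtoℚ β *_) ey)) ez

    middle-exits-miss : ∀ q → (∀ i → suc i <ₙ k → reaches T (exit (suc i)) q ≡ false) → exits-share q ≡ 0ℚ
    middle-exits-miss q miss = sumRange-zero 3 (suc k) (λ i → coefficient i * indicator (sibling p d i) q) term-zero
      where
      term-zero : ∀ i → 3 ≤ₙ i → i ≤ₙ suc k → coefficient i * indicator (sibling p d i) q ≡ 0ℚ
      term-zero (suc (suc (suc i))) _ (s≤s i<k) =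
        trans (cong (coefficient (3 +ₙ i) *_) (indicator-miss (exit (suc i)) q (miss i i<k))) (ℚₚ.*-zeroʳ (coefficient (3 +ₙ i)))
      term-zero (suc zero)       (s≤s ())       _
      term-zero (suc (suc zero)) (s≤s (s≤s ())) _

    middle-exit-hit : ∀ {i} q → suc i <ₙ k → reaches T (exit (suc i)) q ≡ true →
      exits-share q ≡ coefficient (3 +ₙ i) * w q
    middle-exit-hit {i} q i<k r =
      trans (sumRange-single 3 (suc k) (λ i′ → coefficient i′ * indicator (sibling p d i′) q) (3 +ₙ i)
                             (s≤s (s≤s (s≤s z≤n))) (s≤s i<k) term-zero)
            (cong (coefficient (3 +ₙ i) *_) (indicator-hit (exit (suc i)) q r))
      where
      term-zero : ∀ i′ → 3 ≤ₙ i′ → i′ ≤ₙ suc k → i′ ≢ 3 +ₙ i → coefficient i′ * indicator (sibling p d i′) q ≡ 0ℚ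
      term-zero (suc (suc (suc i′))) _ (s≤s i′<k) i′≢i =
        trans (cong (coefficient (3 +ₙ i′) *_)
                    (indicator-miss (exit (suc i′)) q
                      (exit-misses-exit q (ℕₚ.<⇒≤ i<k) (ℕₚ.<⇒≤ i′<k) (λ i′≡i → i′≢i (cong (2 +ₙ_) i′≡i)) r)))
              (ℚₚ.*-zeroʳ (coefficient (3 +ₙ i′)))
      term-zero (suc zero)       (s≤s ())       _ _
      term-zero (suc (suc zero)) (s≤s (s≤s ())) _ _

    charge-none : ∀ q → ℕtoℚ 0 * w q ≤ indicator (exit 0) q
    charge-none q = subst (_≤ indicator (exit 0) q) (sym (ℚₚ.*-zeroˡ (w q))) (indicator-nonNeg (exit 0) q)

    Balanced : Fin n → Set
    Balanced q = w q * ℕtoℚ (depth T′ q) + share q ≤ w q * ℕtoℚ (depth T q) + indicator (exit 0) q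

    -- P is the depth of u₁, X the depth of q below the edge by which it leaves the
    -- path, i + 1 the number of path tests it passes in T, and c + y + 1 in T′.
    balanced : ∀ q P X c y i a b e → depth T′ q ≡ P +ₙ suc (c +ₙ (y +ₙ X)) → depth T q ≡ P +ₙ suc i +ₙ X →
      c +ₙ y +ₙ a ≤ₙ i +ₙ e +ₙ b → share q ≡ (ℕtoℚ a - ℕtoℚ b) * w q → ℕtoℚ e * w q ≤ indicator (exit 0) q → Balanced q
    balanced q P X c y i a b e eT′ eT ineq e-share charge = begin
      w q * ℕtoℚ (depth T′ q) + share q
        ≡⟨ cong₂ (λ x z → w q * ℕtoℚ x + z) eT′ e-share ⟩
      w q * ℕtoℚ after + (ℕtoℚ a - ℕtoℚ b) * w q
        ≤⟨ amortised-≤ after before a b e (w≥0 q) charge (shift-≤ ineq) ⟩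
      w q * ℕtoℚ before + indicator (exit 0) q
        ≡⟨ cong (λ x → w q * ℕtoℚ x + indicator (exit 0) q) (sym eT) ⟩
      w q * ℕtoℚ (depth T q) + indicator (exit 0) q ∎
      where
      open ℚₚ.≤-Reasoning
      after before : ℕ
      after  = P +ₙ suc (c +ₙ (y +ₙ X))
      before = P +ₙ suc i +ₙ X
      shift-≤ : c +ₙ y +ₙ a ≤ₙ i +ₙ e +ₙ b → after +ₙ a ≤ₙ before +ₙ e +ₙ b
      shift-≤ h = subst₂ _≤ₙ_
        (solve 5 (λ P X c y a → (con 1 :+ P :+ X) :+ (c :+ y :+ a) := P :+ (con 1 :+ (c :+ (y :+ X))) :+ a) refl P X c y a)
        (solve 5 (λ P X i e b → (con 1 :+ P :+ X) :+ (i :+ e :+ b) := P :+ (con 1 :+ i) :+ X :+ e :+ b) refl P X i e b)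
        (ℕₚ.+-monoʳ-≤ (suc (P +ₙ X)) h)
        where open ℕ-Solver using (solve; _:+_; _:=_; con)

    balanced-outside : ∀ q → reaches T p q ≡ false → Balanced q
    balanced-outside q r = begin
      w q * ℕtoℚ (depth T′ q) + share q
        ≡⟨ cong₂ (λ x z → w q * ℕtoℚ x + z) (depth-T′-outside q r) share≡0 ⟩
      w q * ℕtoℚ (depth T q) + 0ℚ
        ≤⟨ ℚₚ.+-monoʳ-≤ (w q * ℕtoℚ (depth T q)) (indicator-nonNeg (exit 0) q) ⟩
      w q * ℕtoℚ (depth T q) + indicator (exit 0) q ∎
      where
      open ℚₚ.≤-Reasoning
      miss : ∀ i → reaches T (exit i) q ≡ false
      miss i = reaches-prefix-false T (v i) (not (D i) ∷ []) q (reaches-prefix-false T p (take i d) q r)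
      share≡0 : share q ≡ 0ℚ
      share≡0 = trans (share-≡ q (indicator-miss (v (suc k)) q (reaches-prefix-false T p (take (suc k) d) q r))
                                 (indicator-miss (exit k) q (miss k)) (middle-exits-miss q (λ i _ → miss (suc i))))
                      (trans (ℚₚ.+-identityʳ _) (trans (cong₂ _+_ (ℚₚ.*-zeroʳ (ℕtoℚ k - ℕtoℚ β)) (ℚₚ.*-zeroʳ (ℕtoℚ β))) (ℚₚ.+-identityʳ 0ℚ)))

    balanced-through-bottom : ∀ q → reaches T p q ≡ true → reaches T (v (suc k)) q ≡ true → Balanced q
    balanced-through-bottom q r r-bottom =
      balanced q (length p) X (kept b k) 0 k k β 0
        (depth-T′-through q r (λ s s<k → fol s (ℕₚ.m<n⇒m<1+n s<k)))
        (subst (λ b′ → depth T q ≡ length p +ₙ suc k +ₙ depth (subtreeAt (v k ++ b′ ∷ [])) q) D≡b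
               (depth-below-v (D k) q ℕₚ.≤-refl (trans (cong (λ x → reaches T x q) (sym (v-suc ℕₚ.≤-refl))) r-bottom)))
        (ℕₚ.≤-reflexive (trans (solve 2 (λ c k → c :+ con 0 :+ k := k :+ con 0 :+ c) refl (kept b k) k)
                               (cong (k +ₙ 0 +ₙ_) (trans (cong (λ b′ → kept b′ k) (sym D≡b)) (sym β≡kept)))))
        (trans (share-≡ q (indicator-hit (v (suc k)) q r-bottom)
                          (indicator-miss (exit k) q (bottom-misses-exit q ℕₚ.≤-refl r-bottom))
                          (middle-exits-miss q (λ i i<k → bottom-misses-exit q (ℕₚ.<⇒≤ i<k) r-bottom)))
               (trans (ℚₚ.+-identityʳ _) (trans (cong ((ℕtoℚ k - ℕtoℚ β) * w q +_) (ℚₚ.*-zeroʳ (ℕtoℚ β)))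
                                                 (ℚₚ.+-identityʳ _))))
        (charge-none q)
      where
      open ℕ-Solver using (solve; _:+_; _:=_; con)
      b : Bool
      b = sat pivotTest q
      X : ℕ
      X = depth (subtreeAt (v k ++ b ∷ [])) q
      fol : Follows q (suc k)
      fol = reaches-v⇒follows q ℕₚ.≤-refl r-bottom
      D≡b : D k ≡ b
      D≡b = outcome-unique pivotTest (D k) q (trans (sym (outSat-v ℕₚ.≤-refl (D k) q)) (fol k ℕₚ.≤-refl))

    balanced-last-exit : ∀ q → reaches T p q ≡ true → reaches T (exit k) q ≡ true → Balanced q
    balanced-last-exit q r r-exit =
      balanced q (length p) X (kept b k) 0 k β 0 0
        (depth-T′-through q r fol)
        (subst (λ b′ → depth T q ≡ length p +ₙ suc k +ₙ depth (subtreeAt (v k ++ b′ ∷ [])) q) ¬D≡b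
               (depth-below-v (not (D k)) q ℕₚ.≤-refl r-exit))
        (subst₂ _≤ₙ_ (trans (cong (_+ₙ kept b k) (sym β≡kept)) (solve 2 (λ β c → β :+ c := c :+ con 0 :+ β) refl β (kept b k)))
                     (solve 1 (λ k → k := k :+ con 0 :+ con 0) refl k)
                     (count-disjoint _ _ k (λ s s<k c → subst (λ b′ → consistentWithPivot s b′ ≡ false) ¬D≡b
                                                          (consistentWithPivot-exclusive irr (D k) s<k c))))
        (trans (share-≡ q (indicator-miss (v (suc k)) q (exit-misses-bottom q ℕₚ.≤-refl r-exit))
                          (indicator-hit (exit k) q r-exit)
                          (middle-exits-miss q (λ i i<k → exit-misses-exit q ℕₚ.≤-refl (ℕₚ.<⇒≤ i<k) (ℕₚ.<⇒≢ i<k) r-exit)))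
               (ℚ-solve 3 (λ a b w → a ℚ:* ℚcon 0ℚ ℚ:+ b ℚ:* w ℚ:+ ℚcon 0ℚ ℚ:= (b ℚ:- ℚcon (ℕtoℚ 0)) ℚ:* w) refl
                        (ℕtoℚ k - ℕtoℚ β) (ℕtoℚ β) (w q)))
        (charge-none q)
      where
      open ℕ-Solver using (solve; _:+_; _:=_; con)
      open ℚ-Solver using () renaming (solve to ℚ-solve; _:+_ to _ℚ:+_; _:*_ to _ℚ:*_; _:-_ to _ℚ:-_; _:=_ to _ℚ:=_; con to ℚcon)
      b : Bool
      b = sat pivotTest q
      X : ℕ
      X = depth (subtreeAt (v k ++ b ∷ [])) q
      fol : Follows q k
      fol = proj₁ (exit-reached q ℕₚ.≤-refl r-exit)
      ¬D≡b : not (D k) ≡ b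
      ¬D≡b = outcome-unique pivotTest (not (D k)) q (trans (sym (outSat-v ℕₚ.≤-refl (not (D k)) q)) (proj₂ (exit-reached q ℕₚ.≤-refl r-exit)))

    balanced-first-exit : ∀ q → reaches T p q ≡ true → 0 <ₙ k → reaches T (exit 0) q ≡ true → Balanced q
    balanced-first-exit q r 0<k r-exit =
      balanced q (length p) (depth (subtreeAt (exit 0)) q) 0 1 0 0 0 1
        (depth-T′-exit q r 0<k r-exit)
        (depth-below-v (not (D 0)) q z≤n r-exit)
        ℕₚ.≤-refl
        (trans (share-≡ q (indicator-miss (v (suc k)) q (exit-misses-bottom q z≤n r-exit))
                          (indicator-miss (exit k) q (exit-misses-exit q z≤n ℕₚ.≤-refl (λ k≡0 → ℕₚ.<⇒≢ 0<k (sym k≡0)) r-exit))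
                          (middle-exits-miss q (λ i i<k → exit-misses-exit q z≤n (ℕₚ.<⇒≤ i<k) (λ ()) r-exit)))
               (solve 3 (λ a b w → a :* con 0ℚ :+ b :* con 0ℚ :+ con 0ℚ := (con (ℕtoℚ 0) :- con (ℕtoℚ 0)) :* w) refl
                      (ℕtoℚ k - ℕtoℚ β) (ℕtoℚ β) (w q)))
        (ℚₚ.≤-reflexive (trans (ℚₚ.*-identityˡ (w q)) (sym (indicator-hit (exit 0) q r-exit))))
      where open ℚ-Solver using (solve; _:+_; _:*_; _:-_; _:=_; con)

    balanced-middle-exit : ∀ {i} q → reaches T p q ≡ true → suc i <ₙ k → reaches T (exit (suc i)) q ≡ true → Balanced q
    balanced-middle-exit {i} q r i<k r-exit =
      balanced q (length p) (depth (subtreeAt (exit (suc i))) q) (kept b (suc i)) 1 (suc i) δ 1 0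
        (depth-T′-exit q r i<k r-exit)
        (depth-below-v (not (D (suc i))) q (ℕₚ.<⇒≤ i<k) r-exit)
        (subst₂ _≤ₙ_ (trans (cong (λ x → suc (kept b (suc i) +ₙ x)) (sym δ≡count))
                            (solve 2 (λ c x → con 1 :+ (c :+ x) := c :+ con 1 :+ x) refl (kept b (suc i)) δ))
                     (solve 1 (λ i → con 1 :+ (con 1 :+ i) := con 1 :+ i :+ con 0 :+ con 1) refl i)
                     (s≤s disjoint))
        (trans (share-≡ q (indicator-miss (v (suc k)) q (exit-misses-bottom q (ℕₚ.<⇒≤ i<k) r-exit))
                          (indicator-miss (exit k) q (exit-misses-exit q (ℕₚ.<⇒≤ i<k) ℕₚ.≤-refl (λ k≡1+i → ℕₚ.<⇒≢ i<k (sym k≡1+i)) r-exit))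
                          (middle-exit-hit q i<k r-exit))
               (ℚ-solve 3 (λ a b z → a ℚ:* ℚcon 0ℚ ℚ:+ b ℚ:* ℚcon 0ℚ ℚ:+ z ℚ:= z) refl
                        (ℕtoℚ k - ℕtoℚ β) (ℕtoℚ β) (coefficient (3 +ₙ i) * w q)))
        (charge-none q)
      where
      open ℕ-Solver using (solve; _:+_; _:=_; con)
      open ℚ-Solver using () renaming (solve to ℚ-solve; _:+_ to _ℚ:+_; _:*_ to _ℚ:*_; _:=_ to _ℚ:=_; con to ℚcon)
      b : Bool
      b = sat pivotTest q
      δ : ℕ
      δ = delta T p d (suc k) (3 +ₙ i ∸ 1)
      opposite : ℕ → Bool
      opposite s = oppositeAtUj T p d (suc k) (suc s) (suc (suc i))
      δ≡count : δ ≡ count opposite (suc i)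
      δ≡count = countRange-from-1 _ (suc i)
      consistent-exit : consistentWithPivot (suc i) b ≡ true
      consistent-exit = consistent-intro T _ _ _ _ q (proj₂ (exit-reached q (ℕₚ.<⇒≤ i<k) r-exit)) (pivot-outcome q)
      disjoint : kept b (suc i) +ₙ count opposite (suc i) ≤ₙ suc i
      disjoint = count-disjoint _ _ (suc i) λ s s<1+i c →
        opposite-sides-false (consistentWithPivot s) (consistentWithPivot (suc i)) b
          (consistentWithPivot-exclusive irr b (ℕₚ.<-trans s<1+i i<k) c)
          (consistentWithPivot-exclusive irr b i<k consistent-exit)

    balanced-exit : ∀ i q → reaches T p q ≡ true → i <ₙ k ⊎ i ≡ k → reaches T (exit i) q ≡ true → Balanced q
    balanced-exit i       q r (inj₂ refl) r-exit = balanced-last-exit q r r-exit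
    balanced-exit zero    q r (inj₁ 0<k)  r-exit = balanced-first-exit q r 0<k r-exit
    balanced-exit (suc i) q r (inj₁ i<k)  r-exit = balanced-middle-exit q r i<k r-exit

    balanced-all : ∀ q → Balanced q
    balanced-all q = by-reach (reaches T p q) refl
      where
      by-reach : ∀ x → reaches T p q ≡ x → Balanced q
      by-reach false r = balanced-outside q r
      by-reach true  r = by-position (bottom-or-exit q r)
        where
        by-position : reaches T (v (suc k)) q ≡ true ⊎ ∃[ i ] i ≤ₙ k × reaches T (exit i) q ≡ true → Balanced q
        by-position (inj₁ r-bottom)           = balanced-through-bottom q r r-bottom
        by-position (inj₂ (i , i≤k , r-exit)) = balanced-exit i q r (ℕₚ.m≤n⇒m<n∨m≡n i≤k) r-exit

    cost-exchange : cost w T′ + lhs ≤ cost w T + weight w T (exit 0)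
    cost-exchange = begin
      cost w T′ + lhs                                                ≡⟨ cong (cost w T′ +_) (sym sum-share) ⟩
      cost w T′ + sumFin share                                       ≡⟨ sym (sumFin-+ (λ q → w q * ℕtoℚ (depth T′ q)) share) ⟩
      sumFin (λ q → w q * ℕtoℚ (depth T′ q) + share q)               ≤⟨ sumFin-mono-≤ balanced-all ⟩
      sumFin (λ q → w q * ℕtoℚ (depth T q) + indicator (exit 0) q)   ≡⟨ sumFin-+ (λ q → w q * ℕtoℚ (depth T q)) (indicator (exit 0)) ⟩
      cost w T + weight w T (exit 0)                                 ∎
      where open ℚₚ.≤-Reasoning

lemma3 : ∀ {n m : ℕ} (C : Fin m → Subset n) (K : Subset n) (w : Fin n → ℚ) →
    (∀ (q : Fin n) → 0ℚ ≤ w q) →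
    (∀ (q : Fin n) → ∃ λ (c : Fin m) → q ∈ C c) →
    (T : Tree n m) → IsDecisionTree C K T → Irreducible C T →
    (∀ (T′ : Tree n m) → IsDecisionTree C K T′ → cost w T ≤ cost w T′) →
    (j : ℕ) → 1 Data.Nat.≤ j →
    (p d : List Bool) → length d ≡ j → IsNode T (pathNode p d (Data.Nat.suc j)) →
    (ℕtoℚ (j ∸ 1) - ℕtoℚ (beta T p d j)) * weight w T (pathNode p d (Data.Nat.suc j))
      + ℕtoℚ (beta T p d j) * weight w T (sibling p d (Data.Nat.suc j))
      + sumRange 3 j (λ i → (ℕtoℚ (delta T p d j (i ∸ 1)) - 1ℚ) * weight w T (sibling p d i))
      ≤ weight w T (sibling p d 2)
lemma3 _ _ _ _ _ _ _ _ _ zero () _ _ _ _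
lemma3 C K w w≥0 _ T valid irr optimal (suc k) _ p d len bottom =
  a+x≤b+y∧b≤a⇒x≤y cost-exchange (optimal T′ (T′-isDecisionTree valid))
  where
  open Path T p d k len bottom
  open Accounting w w≥0 irr
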